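{- For every $n\ge 2$, the $n$-dimensional hypercube $Q_n$ is dual-hamiltonian. Moreover, for every $n\ge 3$, $Q_n$ has a hamiltonian coloring that has a quartet.
   Context: $Q_n$ is the graph with vertex set $\{0,1\}^n$ in which two vertices are adjacent iff they differ in exactly one coordinate. For a graph $G$, $|G|$ and $\|G\|$ denote its numbers of vertices and edges. A bond of a connected graph $G$ is a minimal set of edges whose deletion leaves a disconnected graph; every bond has at most $\|G\|-|G|+2$ edges, and a bond of exactly this size is a hamiltonian bond; $G$ is dual-hamiltonian if it has a hamiltonian bond. A $2$-coloring $C$ of $V(G)$ is a hamiltonian coloring if each color class induces a tree in $G$. For $X\subseteq V(G)$, $C\Delta X$ is the coloring obtained from $C$ by switching the colors of vertices in $X$. If $C$ is a hamiltonian coloring and $I,J$ are disjoint $2$-element subsets of $V(G)$, the pair $(I,J)$ is a quartet of $C$ if: (Q1) each of $I$ and $J$ contains one vertex of each color of $C$; (Q2) $C\Delta I$ is a hamiltonian coloring of $G$; (Q3) for each color, the vertices having that color in $C\Delta J$ induce a forest with exactly two connected components, one containing a vertex of $I$ and the other containing a vertex of $J$. -}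

module Defs where

open import Data.Bool using (Bool; true; false; not; if_then_else_; T; _∧_)
open import Data.Nat using (ℕ; zero; suc; _+_; _≤_; _≡ᵇ_)

open import Data.List using (List; []; _∷_; map; _++_; length; filterᵇ; _∷ʳ_)
open import Data.List.Membership.Propositional using (_∈_)
open import Data.List.Relation.Unary.All using (All)
open import Data.List.Relation.Unary.Unique.Propositional using (Unique)
open import Data.List.Relation.Unary.Linked using (Linked)
open import Data.Vec using (Vec; []; _∷_)
open import Data.Vec.Properties using (≡-dec)
import Data.Bool.Properties as BP
open import Data.Product using (Σ; ∃; _×_; _,_; proj₁; proj₂)
open import Data.Sum using (_⊎_)
open import Relation.Binary.PropositionalEquality using (_≡_; _≢_)
open import Relation.Binary.Definitions using (DecidableEquality)
open import Relation.Nullary using (¬_; does)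

-- Finite simple graphs, given by an explicit (duplicate-free) vertex list
-- and a Boolean (symmetric, irreflexive) adjacency test.

record Graph : Set₁ where
  field
    V     : Set
    _≟_   : DecidableEquality V
    verts : List V
    adj   : V → V → Bool

pairs : {A : Set} → List A → List (A × A)
pairs []       = []
pairs (x ∷ xs) = map (x ,_) xs ++ pairs xs

module _ (G : Graph) where
  open Graph G

  order : ℕ
  order = length verts

  size : ℕ
  size = length (filterᵇ (λ p → adj (proj₁ p) (proj₂ p)) (pairs verts))

  EdgeSet : Set
  EdgeSet = V → V → Bool

  IsEdgeSet : EdgeSet → Set
  IsEdgeSet D = (∀ u v → D u v ≡ D v u) × (∀ u v → T (D u v) → T (adj u v))

  _⊆E_ : EdgeSet → EdgeSet → Set
  D ⊆E D' = ∀ u v → T (D u v) → T (D' u v)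

  card : EdgeSet → ℕ
  card D = length (filterᵇ (λ p → D (proj₁ p) (proj₂ p)) (pairs verts))

  data Reach (D : EdgeSet) : V → V → Set where
    here : ∀ {v} → Reach D v v
    step : ∀ {u w v} → T (adj u w) → T (not (D u w)) → Reach D w v → Reach D u v

  Disconnects : EdgeSet → Set
  Disconnects D = Σ V λ u → Σ V λ v → u ∈ verts × v ∈ verts × ¬ Reach D u v

  IsBond : EdgeSet → Set
  IsBond D = IsEdgeSet D × Disconnects D
    × (∀ D' → IsEdgeSet D' → D' ⊆E D → Disconnects D' → D ⊆E D')

  IsHamiltonianBond : EdgeSet → Set
  IsHamiltonianBond D = IsBond D × card D + order ≡ size + 2

  DualHamiltonian : Set
  DualHamiltonian = Σ EdgeSet IsHamiltonianBond

  data ReachIn (S : V → Bool) : V → V → Set where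
    here : ∀ {v} → T (S v) → ReachIn S v v
    step : ∀ {u w v} → T (S u) → T (adj u w) → ReachIn S w v → ReachIn S u v

  IsCycleIn : (V → Bool) → V → List V → Set
  IsCycleIn S x xs = 2 ≤ length xs × Unique (x ∷ xs) × All (λ v → v ∈ verts) (x ∷ xs)
    × All (λ v → T (S v)) (x ∷ xs) × Linked (λ a b → T (adj a b)) ((x ∷ xs) ∷ʳ x)

  IsForest : (V → Bool) → Set
  IsForest S = ∀ x xs → ¬ IsCycleIn S x xs

  IsTree : (V → Bool) → Set
  IsTree S = (Σ V λ v → v ∈ verts × T (S v))
    × (∀ u v → u ∈ verts → v ∈ verts → T (S u) → T (S v) → ReachIn S u v)
    × IsForest S

  Coloring : Set
  Coloring = V → Bool

  colorClass : Coloring → Bool → V → Bool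
  colorClass C c v = does (C v BP.≟ c)

  IsHamiltonianColoring : Coloring → Set
  IsHamiltonianColoring C = IsTree (colorClass C true) × IsTree (colorClass C false)

  switch₂ : Coloring → V → V → Coloring
  switch₂ C a b v = if does (v ≟ a) then not (C v) else (if does (v ≟ b) then not (C v) else C v)

  IsQuartet : Coloring → V → V → V → V → Set
  IsQuartet C a₁ a₂ b₁ b₂ =
    (a₁ ∈ verts × a₂ ∈ verts × b₁ ∈ verts × b₂ ∈ verts)
    × (a₁ ≢ a₂ × b₁ ≢ b₂ × a₁ ≢ b₁ × a₁ ≢ b₂ × a₂ ≢ b₁ × a₂ ≢ b₂)
    × (C a₁ ≢ C a₂ × C b₁ ≢ C b₂)
    × IsHamiltonianColoring (switch₂ C a₁ a₂)
    × (∀ c → let S = colorClass (switch₂ C b₁ b₂) c in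
         IsForest S
         × (Σ V λ x → Σ V λ y → (x ≡ a₁ ⊎ x ≡ a₂) × (y ≡ b₁ ⊎ y ≡ b₂)
             × T (S x) × T (S y) × ¬ ReachIn S x y
             × (∀ v → v ∈ verts → T (S v) → ReachIn S v x ⊎ ReachIn S v y)))

  HasQuartet : Coloring → Set
  HasQuartet C = Σ V λ a₁ → Σ V λ a₂ → Σ V λ b₁ → Σ V λ b₂ → IsQuartet C a₁ a₂ b₁ b₂

allVecs : (n : ℕ) → List (Vec Bool n)
allVecs zero    = [] ∷ []
allVecs (suc n) = map (false ∷_) (allVecs n) ++ map (true ∷_) (allVecs n)

hamming : {n : ℕ} → Vec Bool n → Vec Bool n → ℕ
hamming []       []       = 0
hamming (x ∷ xs) (y ∷ ys) = (if does (x BP.≟ y) then 0 else 1) + hamming xs ys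

Q : ℕ → Graph
Q n = record
  { V     = Vec Bool n
  ; _≟_   = ≡-dec BP._≟_
  ; verts = allVecs n
  ; adj   = λ u v → hamming u v ≡ᵇ 1
  }

-- The cut between the two classes of a hamiltonian colouring is a bond: deleting
-- it leaves exactly the two trees, and putting back any one cut edge reconnects
-- them. Since both classes span trees it has ‖G‖ − |G| + 2 edges.
--
-- Hamiltonian colourings with a quartet (I, J) = ({a₁, a₂}, {b₁, b₂}) are built by
-- induction on n from Q₃, coloured by two stars. Colouring the layer 0 of
-- Q (n + 1) by C and the layer 1 by the complement of C Δ I gives a colouring with
-- the quartet ({0b₁, 0b₂}, {1a₁, 1a₂}). Every colour class involved is a tree or a
-- two-component forest, presented as a rooted forest (parents of decreasing
-- height); those of dimension n + 1 are glued from those of dimension n along the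
-- edges between the layers, and the sizes of the cuts are tracked along the way.

module Submission where

open import Data.Bool using (Bool; true; false; not; if_then_else_; T; T?; _∧_; _∨_; _xor_)
import Data.Bool.Properties as Bool
open import Data.Empty using (⊥; ⊥-elim)
open import Data.List using (List; []; _∷_; map; _++_; length; filterᵇ; _∷ʳ_; cartesianProduct)
open import Data.List.Membership.Propositional using (_∈_)
open import Data.List.Membership.Propositional.Properties using (∈-++⁺ˡ; ∈-++⁺ʳ; ∈-map⁺)
open import Data.List.Properties using (filter-++; length-++; length-map; map-++; map-∘)
open import Data.List.Relation.Unary.All as All using (All; []; _∷_; all?)
open import Data.List.Relation.Unary.AllPairs using (_∷_)
open import Data.List.Relation.Unary.Any using (here; there)
open import Data.List.Relation.Unary.Linked as Linked using (Linked; [-]; _∷_)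
open import Data.List.Relation.Unary.Unique.Propositional using (Unique)
open import Data.Nat using (ℕ; zero; suc; _+_; _≤_; _<_; _≡ᵇ_; _≤ᵇ_; s≤s)
open import Data.Nat.Properties
  using (_<?_; +-suc; +-comm; +-assoc; +-identityʳ; +-cancelʳ-≡; +-monoˡ-<; m≤n+m; m≤m+n; <-trans; <-asym; ≤-refl; ≤-trans)
open import Data.Nat.Tactic.RingSolver using (solve-∀)
open import Data.Product as Product using (Σ; _×_; _,_; proj₁; proj₂; uncurry)
open import Data.Sum as Sum using (_⊎_; inj₁; inj₂)
open import Data.Unit using (tt)
open import Data.Vec using (Vec; []; _∷_)
open import Data.Vec.Properties using (∷-injectiveʳ)
open import Function using (_∘_; Equivalence)
open import Level using (Level)
open import Relation.Binary.PropositionalEquality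
  using (_≡_; _≢_; refl; sym; trans; cong; cong₂; subst; _≗_; module ≡-Reasoning)
open import Relation.Nullary using (¬_; Dec; does; yes; no)
open import Relation.Nullary.Decidable using (dec-true; dec-false; _⊎-dec_; _×-dec_; _→-dec_; ¬?; True; toWitness)

open import Defs

¬T⇒T-not : ∀ {b} → ¬ T b → T (not b)
¬T⇒T-not {false} _ = tt
¬T⇒T-not {true} ¬t = ¬t tt

clash : ∀ {b} → b ≡ true → b ≡ false → ⊥
clash refl ()

≢⇒≡not : ∀ {x y : Bool} → x ≢ y → y ≡ not x
≢⇒≡not {false} {false} x≢y = ⊥-elim (x≢y refl)
≢⇒≡not {false} {true} _ = refl
≢⇒≡not {true} {false} _ = refl
≢⇒≡not {true} {true} x≢y = ⊥-elim (x≢y refl)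

if-yes : {A B : Set} (a? : Dec A) {x y : B} → A → (if does a? then x else y) ≡ x
if-yes a? a rewrite dec-true a? a = refl

if-no : {A B : Set} (a? : Dec A) {x y : B} → ¬ A → (if does a? then x else y) ≡ y
if-no a? ¬a rewrite dec-false a? ¬a = refl

last : {A : Set} → A → List A → A
last w [] = w
last w (x ∷ xs) = last x xs

penultimate : {A : Set} → A → A → List A → A
penultimate w w' [] = w
penultimate w w' (x ∷ xs) = penultimate w' x xs

last-∈ : {A : Set} (w : A) (ws : List A) → last w ws ∈ w ∷ ws
last-∈ w [] = here refl
last-∈ w (x ∷ ws) = there (last-∈ x ws)

penultimate-∈ : {A : Set} (w w' : A) (ws : List A) → penultimate w w' ws ∈ w ∷ w' ∷ ws
penultimate-∈ w w' [] = here refl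
penultimate-∈ w w' (x ∷ ws) = there (penultimate-∈ w' x ws)

Linked-last : {A : Set} {_~_ : A → A → Set} (w w' : A) (ws : List A)
            → Linked _~_ (w ∷ w' ∷ ws) → penultimate w w' ws ~ last w' ws
Linked-last w w' [] (r ∷ _) = r
Linked-last w w' (x ∷ ws) (_ ∷ l) = Linked-last w' x ws l

Linked-∷ʳ⁻ : {A : Set} {_~_ : A → A → Set} (w : A) (ws : List A) (z : A)
           → Linked _~_ ((w ∷ ws) ∷ʳ z) → Linked _~_ (w ∷ ws) × last w ws ~ z
Linked-∷ʳ⁻ w [] z (r ∷ _) = [-] , r
Linked-∷ʳ⁻ w (x ∷ ws) z (r ∷ l) with Linked-∷ʳ⁻ x ws z l
... | l' , r' = (r ∷ l') , r'

count : {A : Set} → (A → Bool) → List A → ℕ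
count P xs = length (filterᵇ P xs)

module _ {A : Set} where

  count-++ : ∀ (P : A → Bool) xs ys → count P (xs ++ ys) ≡ count P xs + count P ys
  count-++ P xs ys = trans (cong length (filter-++ (T? ∘ P) xs ys)) (length-++ (filterᵇ P xs))

  count-cong : ∀ {P P' : A → Bool} → P ≗ P' → ∀ xs → count P xs ≡ count P' xs
  count-cong P≗P' [] = refl
  count-cong {P} {P'} P≗P' (x ∷ xs) with P x | P' x | P≗P' x
  ... | true | true | _ = cong suc (count-cong P≗P' xs)
  ... | false | false | _ = count-cong P≗P' xs

  count-false : ∀ xs → count (λ (_ : A) → false) xs ≡ 0
  count-false [] = refl
  count-false (x ∷ xs) = count-false xs

  count-true : ∀ xs → count (λ (_ : A) → true) xs ≡ length xs
  count-true [] = refl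
  count-true (x ∷ xs) = cong suc (count-true xs)

  count-complement : ∀ (P : A → Bool) xs → count P xs + count (not ∘ P) xs ≡ length xs
  count-complement P [] = refl
  count-complement P (x ∷ xs) with P x
  ... | true = cong suc (count-complement P xs)
  ... | false = trans (+-suc _ _) (cong suc (count-complement P xs))

  count-∨ : ∀ (P P' : A → Bool) → (∀ x → T (P x) → ¬ T (P' x))
          → ∀ xs → count (λ x → P x ∨ P' x) xs ≡ count P xs + count P' xs
  count-∨ P P' disjoint [] = refl
  count-∨ P P' disjoint (x ∷ xs) with P x | P' x | disjoint x
  ... | true | true | d = ⊥-elim (d tt tt)
  ... | true | false | _ = cong suc (count-∨ P P' disjoint xs)
  ... | false | true | _ = trans (cong suc (count-∨ P P' disjoint xs)) (sym (+-suc _ _))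
  ... | false | false | _ = count-∨ P P' disjoint xs

count-map : ∀ {A B : Set} (P : B → Bool) (f : A → B) xs → count P (map f xs) ≡ count (P ∘ f) xs
count-map P f [] = refl
count-map P f (x ∷ xs) with P (f x)
... | true = cong suc (count-map P f xs)
... | false = count-map P f xs

pairs-map : ∀ {A B : Set} (f : A → B) xs → pairs (map f xs) ≡ map (Product.map f f) (pairs xs)
pairs-map f [] = refl
pairs-map f (x ∷ xs) = begin
  map (f x ,_) (map f xs) ++ pairs (map f xs)                        ≡⟨ cong₂ _++_ (sym (map-∘ xs)) (pairs-map f xs) ⟩
  map (Product.map f f ∘ (x ,_)) xs ++ map (Product.map f f) (pairs xs) ≡⟨ cong (_++ _) (map-∘ xs) ⟩
  map (Product.map f f) (map (x ,_) xs) ++ map (Product.map f f) (pairs xs) ≡⟨ map-++ (Product.map f f) (map (x ,_) xs) (pairs xs) ⟨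
  map (Product.map f f) (map (x ,_) xs ++ pairs xs)                  ∎
  where open ≡-Reasoning

cartesianProduct-map : ∀ {A B C D : Set} (f : A → C) (g : B → D) xs ys
  → cartesianProduct (map f xs) (map g ys) ≡ map (Product.map f g) (cartesianProduct xs ys)
cartesianProduct-map f g [] ys = refl
cartesianProduct-map f g (x ∷ xs) ys = begin
  map (f x ,_) (map g ys) ++ cartesianProduct (map f xs) (map g ys)
    ≡⟨ cong₂ _++_ (sym (map-∘ ys)) (cartesianProduct-map f g xs ys) ⟩
  map (Product.map f g ∘ (x ,_)) ys ++ map (Product.map f g) (cartesianProduct xs ys)
    ≡⟨ cong (_++ _) (map-∘ ys) ⟩
  map (Product.map f g) (map (x ,_) ys) ++ map (Product.map f g) (cartesianProduct xs ys)
    ≡⟨ map-++ (Product.map f g) (map (x ,_) ys) (cartesianProduct xs ys) ⟨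
  map (Product.map f g) (map (x ,_) ys ++ cartesianProduct xs ys) ∎
  where open ≡-Reasoning

count-pairs-++ : ∀ {A : Set} (P : A × A → Bool) xs ys
  → count P (pairs (xs ++ ys)) ≡ count P (pairs xs) + count P (pairs ys) + count P (cartesianProduct xs ys)
count-pairs-++ P [] ys = sym (+-identityʳ _)
count-pairs-++ {A} P (x ∷ xs) ys = begin
  count P (map (x ,_) (xs ++ ys) ++ pairs (xs ++ ys))
    ≡⟨ row (xs ++ ys) (pairs (xs ++ ys)) ⟩
  Px (xs ++ ys) + count P (pairs (xs ++ ys))
    ≡⟨ cong₂ _+_ (count-++ _ xs ys) (count-pairs-++ P xs ys) ⟩
  (Px xs + Px ys) + (count P (pairs xs) + count P (pairs ys) + count P (cartesianProduct xs ys))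
    ≡⟨ regroup (Px xs) (Px ys) (count P (pairs xs)) _ _ ⟩
  (Px xs + count P (pairs xs)) + count P (pairs ys) + (Px ys + count P (cartesianProduct xs ys))
    ≡⟨ cong₂ (λ a b → a + count P (pairs ys) + b) (row xs (pairs xs)) (row ys (cartesianProduct xs ys)) ⟨
  count P (pairs (x ∷ xs)) + count P (pairs ys) + count P (cartesianProduct (x ∷ xs) ys) ∎
  where
    open ≡-Reasoning
    Px : List A → ℕ
    Px = count (λ y → P (x , y))
    row : ∀ zs rest → count P (map (x ,_) zs ++ rest) ≡ Px zs + count P rest
    row zs rest = trans (count-++ P (map (x ,_) zs) rest) (cong (_+ count P rest) (count-map P (x ,_) zs))
    regroup : ∀ a b c d e → (a + b) + (c + d + e) ≡ (a + c) + d + (b + e)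
    regroup = solve-∀

variable
  n : ℕ

Vertex : ℕ → Set
Vertex n = Vec Bool n

VertexSet : ℕ → Set
VertexSet n = Vertex n → Bool

_≟ᵛ_ : (u v : Vertex n) → Dec (u ≡ v)
_≟ᵛ_ {n} = Graph._≟_ (Q n)

does⇒≡ : (u v : Vertex n) → T (does (u ≟ᵛ v)) → u ≡ v
does⇒≡ u v t with u ≟ᵛ v
... | yes u≡v = u≡v

∈-allVecs : (v : Vertex n) → v ∈ allVecs n
∈-allVecs [] = here refl
∈-allVecs (false ∷ v) = ∈-++⁺ˡ (∈-map⁺ (false ∷_) (∈-allVecs v))
∈-allVecs {suc n} (true ∷ v) = ∈-++⁺ʳ (map (false ∷_) (allVecs n)) (∈-map⁺ (true ∷_) (∈-allVecs v))

Adjacent : Vertex n → Vertex n → Set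
Adjacent {n} u v = T (Graph.adj (Q n) u v)

hamming-sym : (u v : Vertex n) → hamming u v ≡ hamming v u
hamming-sym [] [] = refl
hamming-sym (false ∷ u) (false ∷ v) = hamming-sym u v
hamming-sym (false ∷ u) (true ∷ v) = cong suc (hamming-sym u v)
hamming-sym (true ∷ u) (false ∷ v) = cong suc (hamming-sym u v)
hamming-sym (true ∷ u) (true ∷ v) = hamming-sym u v

hamming-refl : (u : Vertex n) → hamming u u ≡ 0
hamming-refl [] = refl
hamming-refl (false ∷ u) = hamming-refl u
hamming-refl (true ∷ u) = hamming-refl u

hamming≡0⇒≡ : (u v : Vertex n) → T (hamming u v ≡ᵇ 0) → u ≡ v
hamming≡0⇒≡ [] [] _ = refl
hamming≡0⇒≡ (false ∷ u) (false ∷ v) t = cong (false ∷_) (hamming≡0⇒≡ u v t)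
hamming≡0⇒≡ (true ∷ u) (true ∷ v) t = cong (true ∷_) (hamming≡0⇒≡ u v t)

Adjacent-sym : (u v : Vertex n) → Adjacent u v → Adjacent v u
Adjacent-sym u v t rewrite hamming-sym u v = t

Adjacent-cases : (x y : Bool) (u v : Vertex n) → Adjacent (x ∷ u) (y ∷ v)
               → (x ≡ y × Adjacent u v) ⊎ (x ≢ y × u ≡ v)
Adjacent-cases false false u v t = inj₁ (refl , t)
Adjacent-cases true true u v t = inj₁ (refl , t)
Adjacent-cases false true u v t = inj₂ ((λ ()) , hamming≡0⇒≡ u v t)
Adjacent-cases true false u v t = inj₂ ((λ ()) , hamming≡0⇒≡ u v t)

Adjacent-∷ : (x : Bool) {u v : Vertex n} → Adjacent u v → Adjacent (x ∷ u) (x ∷ v)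
Adjacent-∷ false a = a
Adjacent-∷ true a = a

Adjacent-copies : (x : Bool) (v : Vertex n) → Adjacent (x ∷ v) (not x ∷ v)
Adjacent-copies false v rewrite hamming-refl v = tt
Adjacent-copies true v rewrite hamming-refl v = tt

Reaches : VertexSet n → Vertex n → Vertex n → Set
Reaches {n} = ReachIn (Q n)

module _ {S : VertexSet n} where

  Reaches-start : ∀ {u v} → Reaches S u v → T (S u)
  Reaches-start (here s) = s
  Reaches-start (step s _ _) = s

  Reaches-trans : ∀ {u v w} → Reaches S u v → Reaches S v w → Reaches S u w
  Reaches-trans (here _) q = q
  Reaches-trans (step s a p) q = step s a (Reaches-trans p q)

  Reaches-sym : ∀ {u v} → Reaches S u v → Reaches S v u
  Reaches-sym (here s) = here s
  Reaches-sym {u} (step {w = w} s a p) =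
    Reaches-trans (Reaches-sym p) (step (Reaches-start p) (Adjacent-sym u w a) (here s))

  Reaches-invariant : {A : Set} (g : Vertex n → A)
    → (∀ {u v} → T (S u) → T (S v) → Adjacent u v → g u ≡ g v)
    → ∀ {u v} → Reaches S u v → g u ≡ g v
  Reaches-invariant g g-edge (here _) = refl
  Reaches-invariant g g-edge (step s a p) = trans (g-edge s (Reaches-start p) a) (Reaches-invariant g g-edge p)

ParentEdge : (Vertex n → Set) → (Vertex n → Vertex n) → Vertex n → Vertex n → Set
ParentEdge R parent u v = ¬ R u × parent u ≡ v

-- G[S] is a forest in which every component contains a vertex of R: each
-- non-root points to an adjacent parent of smaller height, and every edge of G[S]
-- is a parent edge.
record RootedForest (S : VertexSet n) (R : Vertex n → Set) : Set where
  field
    root? : ∀ v → Dec (R v)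
    parent : Vertex n → Vertex n
    height : Vertex n → ℕ
    root∈ : ∀ {v} → R v → T (S v)
    parent∈ : ∀ {v} → T (S v) → ¬ R v → T (S (parent v))
    parent-adjacent : ∀ {v} → T (S v) → ¬ R v → Adjacent v (parent v)
    parent-lower : ∀ {v} → T (S v) → ¬ R v → height (parent v) < height v
    edge-is-parent-edge : ∀ {u v} → T (S u) → T (S v) → Adjacent u v
                        → ParentEdge R parent u v ⊎ ParentEdge R parent v u

module _ {S : VertexSet n} {R : Vertex n → Set} (F : RootedForest S R) where
  open RootedForest F

  Child : Vertex n → Vertex n → Set
  Child u v = T (S u) × ParentEdge R parent u v

  Child⇒lower : ∀ {u v} → Child u v → height v < height u
  Child⇒lower (s , ¬r , refl) = parent-lower s ¬r

  orient : ∀ {u v} → T (S u) → T (S v) → Adjacent u v → Child u v ⊎ Child v u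
  orient su sv a with edge-is-parent-edge su sv a
  ... | inj₁ e = inj₁ (su , e)
  ... | inj₂ e = inj₂ (sv , e)

  private
    InS : Vertex n → Set
    InS v = T (S v)

  -- A vertex has only one parent, so a path without repeated vertices that
  -- starts by stepping down away from the parent keeps stepping down.
  descending : ∀ w w' ws → Linked Adjacent (w ∷ w' ∷ ws) → All InS (w ∷ w' ∷ ws) → Unique (w ∷ w' ∷ ws)
             → Child w' w → height w < height (last w' ws) × Child (last w' ws) (penultimate w w' ws)
  descending w w' [] _ _ _ c = Child⇒lower c , c
  descending w w' (w'' ∷ ws) (_ ∷ l) (_ ∷ s' ∷ s'' ∷ ss) ((_ ∷ w≢w'' ∷ _) ∷ u) c@(_ , _ , w'↑w)
    with orient s' s'' (Linked.head l)
  ... | inj₁ (_ , _ , w'↑w'') = ⊥-elim (w≢w'' (trans (sym w'↑w) w'↑w''))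
  ... | inj₂ c' with descending w' w'' ws l (s' ∷ s'' ∷ ss) u c'
  ...   | lt , c'' = <-trans (Child⇒lower c) lt , c''

  ascending : ∀ w w' ws → Linked Adjacent (w ∷ w' ∷ ws) → All InS (w ∷ w' ∷ ws) → Unique (w ∷ w' ∷ ws)
            → Child (penultimate w w' ws) (last w' ws) → height (last w' ws) < height w × Child w w'
  ascending w w' [] _ _ _ c = Child⇒lower c , c
  ascending w w' (w'' ∷ ws) (a ∷ l) (s ∷ s' ∷ s'' ∷ ss) ((_ ∷ w≢w'' ∷ _) ∷ u) c
    with ascending w' w'' ws l (s' ∷ s'' ∷ ss) u c
  ... | lt , (_ , _ , w'↑w'') with orient s s' a
  ...   | inj₁ c' = <-trans lt (Child⇒lower c') , c'
  ...   | inj₂ (_ , _ , w'↑w) = ⊥-elim (w≢w'' (trans (sym w'↑w) w'↑w''))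

  -- Orient the first edge x x₁ and the closing edge L x of a cycle x x₁ … P L:
  -- each of the four combinations contradicts uniqueness of parents or the
  -- strict decrease of heights.
  isForest : IsForest (Q n) S
  isForest x (_ ∷ []) (s≤s () , _)
  isForest x (x₁ ∷ x₂ ∷ xs) (_ , uq@(x∉ ∷ x₁∉ ∷ _) , _ , ss , cyc)
    with Linked-∷ʳ⁻ x (x₁ ∷ x₂ ∷ xs) x cyc
  ... | path , closing =
    cases (orient (All.head ss) (All.lookup ss (there (here refl))) (Linked.head path))
          (orient sL (All.head ss) closing) (orient sP sL (Linked-last x x₁ (x₂ ∷ xs) path))
    where
      L P : Vertex n
      L = last x₂ xs
      P = penultimate x₁ x₂ xs
      sL : T (S L)
      sL = All.lookup ss (last-∈ x (x₁ ∷ x₂ ∷ xs))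
      sP : T (S P)
      sP = All.lookup ss (there (penultimate-∈ x₁ x₂ xs))
      x≢P : x ≢ P
      x≢P = All.lookup x∉ (penultimate-∈ x₁ x₂ xs)
      x₁≢L : x₁ ≢ L
      x₁≢L = All.lookup x₁∉ (last-∈ x₂ xs)
      cases : Child x x₁ ⊎ Child x₁ x → Child L x ⊎ Child x L → Child P L ⊎ Child L P → ⊥
      cases (inj₂ down) closing _ with descending x x₁ (x₂ ∷ xs) path ss uq down
      ... | lt , (_ , _ , L↑P) with closing
      ...   | inj₁ (_ , _ , L↑x) = x≢P (trans (sym L↑x) L↑P)
      ...   | inj₂ up = <-asym lt (Child⇒lower up)
      cases (inj₁ (_ , _ , x↑x₁)) (inj₂ (_ , _ , x↑L)) _ = x₁≢L (trans (sym x↑x₁) x↑L)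
      cases (inj₁ _) (inj₁ (_ , _ , L↑x)) (inj₂ (_ , _ , L↑P)) = x≢P (trans (sym L↑x) L↑P)
      cases (inj₁ _) (inj₁ down) (inj₁ up) = <-asym (Child⇒lower down) (proj₁ (ascending x x₁ (x₂ ∷ xs) path ss uq up))

  -- Parents lower the height, so height v + 1 steps up from v reach a root.
  climb : ℕ → Vertex n → Vertex n
  climb zero v = v
  climb (suc k) v = if does (root? v) then v else climb k (parent v)

  root : Vertex n → Vertex n
  root v = climb (suc (height v)) v

  climb-nonroot : ∀ {k v} → ¬ R v → climb (suc k) v ≡ climb k (parent v)
  climb-nonroot {v = v} = if-no (root? v)

  climb-stable : ∀ k k' {v} → T (S v) → height v < k → height v < k' → climb k v ≡ climb k' v
  climb-stable (suc k) (suc k') {v} s (s≤s h≤k) (s≤s h≤k') with root? v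
  ... | yes _ = refl
  ... | no ¬r = climb-stable k k' (parent∈ s ¬r) (≤-trans (parent-lower s ¬r) h≤k) (≤-trans (parent-lower s ¬r) h≤k')

  climb-reaches-root : ∀ k {v} → T (S v) → height v < k → R (climb k v) × Reaches S v (climb k v)
  climb-reaches-root (suc k) {v} s (s≤s h≤k) with root? v
  ... | yes r = r , here s
  ... | no ¬r =
    let r , p = climb-reaches-root k (parent∈ s ¬r) (≤-trans (parent-lower s ¬r) h≤k)
    in r , step s (parent-adjacent s ¬r) p

  root-is-root : ∀ {v} → T (S v) → R (root v)
  root-is-root s = proj₁ (climb-reaches-root _ s ≤-refl)

  reaches-root : ∀ {v} → T (S v) → Reaches S v (root v)
  reaches-root s = proj₂ (climb-reaches-root _ s ≤-refl)

  root-of-root : ∀ {v} → R v → root v ≡ v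
  root-of-root {v} = if-yes (root? v)

  root-parent : ∀ {v} → T (S v) → ¬ R v → root (parent v) ≡ root v
  root-parent {v} s ¬r = begin
    root (parent v)               ≡⟨ climb-stable _ _ (parent∈ s ¬r) ≤-refl (parent-lower s ¬r) ⟩
    climb (height v) (parent v)   ≡⟨ climb-nonroot {height v} ¬r ⟨
    root v                        ∎
    where open ≡-Reasoning

  Reaches⇒root≡ : ∀ {u v} → Reaches S u v → root u ≡ root v
  Reaches⇒root≡ = Reaches-invariant root root-edge
    where
      root-edge : ∀ {u v} → T (S u) → T (S v) → Adjacent u v → root u ≡ root v
      root-edge su sv a with orient su sv a
      ... | inj₁ (_ , ¬r , refl) = sym (root-parent su ¬r)
      ... | inj₂ (_ , ¬r , refl) = root-parent sv ¬r

  roots-unreachable : ∀ {x y} → R x → R y → x ≢ y → ¬ Reaches S x y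
  roots-unreachable {x} {y} rx ry x≢y p = x≢y (begin
    x      ≡⟨ root-of-root rx ⟨
    root x ≡⟨ Reaches⇒root≡ p ⟩
    root y ≡⟨ root-of-root ry ⟩
    y      ∎)
    where open ≡-Reasoning

RootedTree : VertexSet n → Vertex n → Set
RootedTree S r = RootedForest S (_≡ r)

RootedTree⇒IsTree : ∀ {S : VertexSet n} {r} → RootedTree S r → IsTree (Q n) S
RootedTree⇒IsTree {n} {S} {r} F = (r , ∈-allVecs r , root∈ refl) , connected , isForest F
  where
    open RootedForest F
    reaches-r : ∀ {v} → T (S v) → Reaches S v r
    reaches-r s = subst (Reaches S _) (root-is-root F s) (reaches-root F s)
    connected : ∀ u v → u ∈ allVecs n → v ∈ allVecs n → T (S u) → T (S v) → Reaches S u v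
    connected u v _ _ su sv = Reaches-trans (reaches-r su) (Reaches-sym (reaches-r sv))

TwoRootedForest : VertexSet n → Vertex n → Vertex n → Set
TwoRootedForest S x y = RootedForest S (λ v → v ≡ x ⊎ v ≡ y)

roots? : (x y v : Vertex n) → Dec (v ≡ x ⊎ v ≡ y)
roots? x y v = (v ≟ᵛ x) ⊎-dec (v ≟ᵛ y)

reaches-one-of : ∀ {S : VertexSet n} {x y} (F : TwoRootedForest S x y)
               → ∀ {v} → T (S v) → Reaches S v x ⊎ Reaches S v y
reaches-one-of {S = S} F {v} s =
  Sum.map (λ e → subst (Reaches S v) e (reaches-root F s)) (λ e → subst (Reaches S v) e (reaches-root F s))
          (root-is-root F s)

TwoRootedForest⇒components : ∀ {S : VertexSet n} {x y} → TwoRootedForest S x y → x ≢ y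
  → IsForest (Q n) S × T (S x) × T (S y) × ¬ Reaches S x y
    × (∀ v → v ∈ allVecs n → T (S v) → Reaches S v x ⊎ Reaches S v y)
TwoRootedForest⇒components F x≢y =
  isForest F , root∈ (inj₁ refl) , root∈ (inj₂ refl) , roots-unreachable F (inj₁ refl) (inj₂ refl) x≢y ,
  λ _ _ → reaches-one-of F
  where open RootedForest F

RootedForest-resp : ∀ {S S' : VertexSet n} {R} → S ≗ S' → RootedForest S R → RootedForest S' R
RootedForest-resp {S = S} {S'} S≗S' F = record
  { root? = root?
  ; parent = parent
  ; height = height
  ; root∈ = λ r → toS (root∈ r)
  ; parent∈ = λ s ¬r → toS (parent∈ (fromS s) ¬r)
  ; parent-adjacent = λ s → parent-adjacent (fromS s)
  ; parent-lower = λ s → parent-lower (fromS s)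
  ; edge-is-parent-edge = λ su sv → edge-is-parent-edge (fromS su) (fromS sv)
  }
  where
    open RootedForest F
    toS : ∀ {v} → T (S v) → T (S' v)
    toS {v} = subst T (S≗S' v)
    fromS : ∀ {v} → T (S' v) → T (S v)
    fromS {v} = subst T (sym (S≗S' v))

module RootedForestCheck {S : VertexSet n} {R : Vertex n → Set} (root? : ∀ v → Dec (R v))
  (parent : Vertex n → Vertex n) (height : Vertex n → ℕ) where

  RootOK : Vertex n → Set
  RootOK v = R v → T (S v)

  ParentOK : Vertex n → Set
  ParentOK v = T (S v) → ¬ R v → T (S (parent v)) × Adjacent v (parent v) × height (parent v) < height v

  EdgeOK : Vertex n → Vertex n → Set
  EdgeOK u v = T (S u) → T (S v) → Adjacent u v → ParentEdge R parent u v ⊎ ParentEdge R parent v u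

  Checks : Set
  Checks = All RootOK (allVecs n) × All ParentOK (allVecs n) × All (λ u → All (EdgeOK u) (allVecs n)) (allVecs n)

  checks? : Dec Checks
  checks? = all? rootOK? (allVecs n) ×-dec all? parentOK? (allVecs n) ×-dec all? (λ u → all? (edgeOK? u) (allVecs n)) (allVecs n)
    where
      rootOK? : ∀ v → Dec (RootOK v)
      rootOK? v = root? v →-dec T? (S v)
      parentOK? : ∀ v → Dec (ParentOK v)
      parentOK? v = T? (S v) →-dec (¬? (root? v) →-dec
        (T? (S (parent v)) ×-dec T? (Graph.adj (Q n) v (parent v)) ×-dec height (parent v) <? height v))
      parentEdge? : ∀ u v → Dec (ParentEdge R parent u v)
      parentEdge? u v = ¬? (root? u) ×-dec (parent u ≟ᵛ v)
      edgeOK? : ∀ u v → Dec (EdgeOK u v)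
      edgeOK? u v = T? (S u) →-dec (T? (S v) →-dec (T? (Graph.adj (Q n) u v) →-dec (parentEdge? u v ⊎-dec parentEdge? v u)))

  fromChecks : Checks → RootedForest S R
  fromChecks (rootOK , parentOK , edgeOK) = record
    { root? = root?
    ; parent = parent
    ; height = height
    ; root∈ = λ {v} → All.lookup rootOK (∈-allVecs v)
    ; parent∈ = λ {v} s ¬r → proj₁ (All.lookup parentOK (∈-allVecs v) s ¬r)
    ; parent-adjacent = λ {v} s ¬r → proj₁ (proj₂ (All.lookup parentOK (∈-allVecs v) s ¬r))
    ; parent-lower = λ {v} s ¬r → proj₂ (proj₂ (All.lookup parentOK (∈-allVecs v) s ¬r))
    ; edge-is-parent-edge = λ {u} {v} → All.lookup (All.lookup edgeOK (∈-allVecs u)) (∈-allVecs v)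
    }

parentFrom : List (Vertex n × Vertex n) → Vertex n → Vertex n
parentFrom [] v = v
parentFrom ((child , p) ∷ edges) v = if does (v ≟ᵛ child) then p else parentFrom edges v

depth : {R : Vertex n → Set} → (∀ v → Dec (R v)) → (Vertex n → Vertex n) → ℕ → Vertex n → ℕ
depth root? parent zero v = 0
depth root? parent (suc k) v = if does (root? v) then 0 else suc (depth root? parent k (parent v))

forestFrom : ∀ (S : VertexSet n) {R : Vertex n → Set} (root? : ∀ v → Dec (R v)) (edges : List (Vertex n × Vertex n))
           → let open RootedForestCheck {S = S} root? (parentFrom edges) (depth root? (parentFrom edges) (order (Q n)))
             in {True checks?} → RootedForest S R
forestFrom {n} S root? edges {ok} = fromChecks (toWitness ok)
  where open RootedForestCheck {S = S} root? (parentFrom edges) (depth root? (parentFrom edges) (order (Q n)))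

stack : (Bool → VertexSet n) → VertexSet (suc n)
stack S (x ∷ v) = S x v

layers : {ℓ : Level} {A : Set ℓ} → A → A → Bool → A
layers a b false = a
layers a b true = b

-- Rooted forests on the two layers of Q (suc n) combine into one when every
-- vertex v lying in both layers is a root, in some layer x, which is demoted and
-- hangs from its copy in the other layer.
module Glue {S₀ S₁ : VertexSet n} {R₀ R₁ : Vertex n → Set}
  (F₀ : RootedForest S₀ R₀) (F₁ : RootedForest S₁ R₁) where

  S : Bool → VertexSet n
  S = layers S₀ S₁

  R : Bool → Vertex n → Set
  R = layers R₀ R₁

  F : (x : Bool) → RootedForest (S x) (R x)
  F false = F₀
  F true = F₁

  private
    module F x = RootedForest (F x)

  NewRootsOld : (Vertex (suc n) → Set) → Set
  NewRootsOld R' = ∀ {x v} → R' (x ∷ v) → R x v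

  LowerInLayer : (Vertex (suc n) → ℕ) → Set
  LowerInLayer height = ∀ {x v} → T (S x v) → ¬ R x v → height (x ∷ F.parent x v) < height (x ∷ v)

  DemotedHangAcross : (Vertex (suc n) → Set) → (Vertex (suc n) → ℕ) → Set
  DemotedHangAcross R' height = ∀ {x v} → T (S x v) → R x v → ¬ R' (x ∷ v)
                              → T (S (not x) v) × height (not x ∷ v) < height (x ∷ v)

  SharedRootsDemoted : (Vertex (suc n) → Set) → Set
  SharedRootsDemoted R' = ∀ {v} → T (S₀ v) → T (S₁ v) → Σ Bool λ x → R x v × ¬ R' (x ∷ v)

  module _ {R' : Vertex (suc n) → Set} (root? : ∀ w → Dec (R' w)) (height : Vertex (suc n) → ℕ)
    (roots-old : NewRootsOld R') (lower-in-layer : LowerInLayer height)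
    (demoted-cross : DemotedHangAcross R' height) (shared-demoted : SharedRootsDemoted R')
    where

    parent : Vertex (suc n) → Vertex (suc n)
    parent (x ∷ v) = if does (F.root? x v) then not x ∷ v else x ∷ F.parent x v

    parent-root : ∀ {x v} → R x v → parent (x ∷ v) ≡ not x ∷ v
    parent-root {x} {v} = if-yes (F.root? x v)

    parent-nonroot : ∀ {x v} → ¬ R x v → parent (x ∷ v) ≡ x ∷ F.parent x v
    parent-nonroot {x} {v} = if-no (F.root? x v)

    parent∈ : ∀ {w} → T (stack S w) → ¬ R' w → T (stack S (parent w))
    parent∈ {x ∷ v} s ¬r' with F.root? x v
    ... | yes r = proj₁ (demoted-cross s r ¬r')
    ... | no ¬r = F.parent∈ x s ¬r

    parent-adjacent : ∀ {w} → T (stack S w) → ¬ R' w → Adjacent w (parent w)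
    parent-adjacent {x ∷ v} s ¬r' with F.root? x v
    ... | yes r = Adjacent-copies x v
    ... | no ¬r = Adjacent-∷ x {v} (F.parent-adjacent x s ¬r)

    parent-lower : ∀ {w} → T (stack S w) → ¬ R' w → height (parent w) < height w
    parent-lower {x ∷ v} s ¬r' with F.root? x v
    ... | yes r = proj₂ (demoted-cross s r ¬r')
    ... | no ¬r = lower-in-layer s ¬r

    vertical-edge : ∀ {x v} → T (S x v) → T (S (not x) v)
                  → ParentEdge R' parent (x ∷ v) (not x ∷ v) ⊎ ParentEdge R' parent (not x ∷ v) (x ∷ v)
    vertical-edge {false} s s' with shared-demoted s s'
    ... | false , r , ¬r' = inj₁ (¬r' , parent-root r)
    ... | true , r , ¬r' = inj₂ (¬r' , parent-root r)
    vertical-edge {true} s s' with shared-demoted s' s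
    ... | false , r , ¬r' = inj₂ (¬r' , parent-root r)
    ... | true , r , ¬r' = inj₁ (¬r' , parent-root r)

    edge-is-parent-edge : ∀ {u w} → T (stack S u) → T (stack S w) → Adjacent u w
                        → ParentEdge R' parent u w ⊎ ParentEdge R' parent w u
    edge-is-parent-edge {x ∷ u} {y ∷ v} su sv a with Adjacent-cases x y u v a
    ... | inj₁ (refl , a') = Sum.map lift lift (F.edge-is-parent-edge x su sv a')
      where
        lift : ∀ {u v} → ParentEdge (R x) (F.parent x) u v → ParentEdge R' parent (x ∷ u) (x ∷ v)
        lift (¬r , refl) = ¬r ∘ roots-old , parent-nonroot ¬r
    ... | inj₂ (x≢y , refl) with ≢⇒≡not x≢y
    ...   | refl = vertical-edge su sv

    root∈ : ∀ {w} → R' w → T (stack S w)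
    root∈ {x ∷ v} r' = F.root∈ x (roots-old r')

    glued : RootedForest (stack S) R'
    glued = record
      { root? = root?
      ; parent = parent
      ; height = height
      ; root∈ = root∈
      ; parent∈ = parent∈
      ; parent-adjacent = parent-adjacent
      ; parent-lower = parent-lower
      ; edge-is-parent-edge = edge-is-parent-edge
      }

-- In each gluing the heights of the part that is hung from the other layer are
-- shifted above the height of its attachment point.
module _ {S₀ S₁ : VertexSet n} where
  open Glue using (NewRootsOld; LowerInLayer; DemotedHangAcross; SharedRootsDemoted; glued)
  open RootedForest using (height; parent-lower; root∈)

  join-trees₀ : ∀ {r q} (F₀ : RootedTree S₀ r) (F₁ : RootedTree S₁ q)
              → (∀ {v} → T (S₀ v) → T (S₁ v) → v ≡ q) → T (S₀ q)
              → RootedTree (stack (layers S₀ S₁)) (false ∷ r)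
  join-trees₀ {r} {q} F₀ F₁ shared q∈S₀ =
    glued F₀ F₁ (_≟ᵛ (false ∷ r)) h roots-old lower-in-layer demoted-cross shared-demoted
    where
      h : Vertex (suc n) → ℕ
      h (false ∷ v) = height F₀ v
      h (true ∷ v) = height F₁ v + suc (height F₀ q)
      roots-old : NewRootsOld F₀ F₁ (_≡ false ∷ r)
      roots-old {false} refl = refl
      lower-in-layer : LowerInLayer F₀ F₁ h
      lower-in-layer {false} = parent-lower F₀
      lower-in-layer {true} s ¬r = +-monoˡ-< _ (parent-lower F₁ s ¬r)
      demoted-cross : DemotedHangAcross F₀ F₁ (_≡ false ∷ r) h
      demoted-cross {false} _ refl ¬r' = ⊥-elim (¬r' refl)
      demoted-cross {true} _ refl _ = q∈S₀ , m≤n+m _ _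
      shared-demoted : SharedRootsDemoted F₀ F₁ (_≡ false ∷ r)
      shared-demoted s₀ s₁ with refl ← shared s₀ s₁ = true , refl , λ ()

  join-trees₁ : ∀ {q r} (F₀ : RootedTree S₀ q) (F₁ : RootedTree S₁ r)
              → (∀ {v} → T (S₀ v) → T (S₁ v) → v ≡ q) → T (S₁ q)
              → RootedTree (stack (layers S₀ S₁)) (true ∷ r)
  join-trees₁ {q} {r} F₀ F₁ shared q∈S₁ =
    glued F₀ F₁ (_≟ᵛ (true ∷ r)) h roots-old lower-in-layer demoted-cross shared-demoted
    where
      h : Vertex (suc n) → ℕ
      h (false ∷ v) = height F₀ v + suc (height F₁ q)
      h (true ∷ v) = height F₁ v
      roots-old : NewRootsOld F₀ F₁ (_≡ true ∷ r)
      roots-old {true} refl = refl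
      lower-in-layer : LowerInLayer F₀ F₁ h
      lower-in-layer {false} s ¬r = +-monoˡ-< _ (parent-lower F₀ s ¬r)
      lower-in-layer {true} = parent-lower F₁
      demoted-cross : DemotedHangAcross F₀ F₁ (_≡ true ∷ r) h
      demoted-cross {false} _ refl _ = q∈S₁ , m≤n+m _ _
      demoted-cross {true} _ refl ¬r' = ⊥-elim (¬r' refl)
      shared-demoted : SharedRootsDemoted F₀ F₁ (_≡ true ∷ r)
      shared-demoted s₀ s₁ with refl ← shared s₀ s₁ = false , refl , λ ()

  -- The component of x in layer 0 hangs from layer 1 and layer 1 hangs from 0y;
  -- the heights in that component are raised above all of layer 1 to make room.
  join-forest-tree₀ : ∀ {x y} (F₀ : TwoRootedForest S₀ x y) (F₁ : RootedTree S₁ y) → x ≢ y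
                    → (∀ {v} → T (S₀ v) → T (S₁ v) → v ≡ x ⊎ v ≡ y) → T (S₁ x)
                    → RootedTree (stack (layers S₀ S₁)) (false ∷ y)
  join-forest-tree₀ {x} {y} F₀ F₁ x≢y shared x∈S₁ =
    glued F₀ F₁ (_≟ᵛ (false ∷ y)) h roots-old lower-in-layer demoted-cross shared-demoted
    where
      offset : Vertex n → ℕ
      offset v = if does (root F₀ v ≟ᵛ y) then 0 else suc (height F₁ x + suc (height F₀ y))
      h : Vertex (suc n) → ℕ
      h (false ∷ v) = height F₀ v + offset v
      h (true ∷ v) = height F₁ v + suc (height F₀ y)
      roots-old : NewRootsOld F₀ F₁ (_≡ false ∷ y)
      roots-old {false} refl = inj₂ refl
      lower-in-layer : LowerInLayer F₀ F₁ h
      lower-in-layer {false} s ¬r rewrite root-parent F₀ s ¬r = +-monoˡ-< _ (parent-lower F₀ s ¬r)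
      lower-in-layer {true} s ¬r = +-monoˡ-< _ (parent-lower F₁ s ¬r)
      demoted-cross : DemotedHangAcross F₀ F₁ (_≡ false ∷ y) h
      demoted-cross {false} _ (inj₁ refl) _
        rewrite root-of-root F₀ (inj₁ refl) | dec-false (x ≟ᵛ y) x≢y = x∈S₁ , m≤n+m _ _
      demoted-cross {false} _ (inj₂ refl) ¬r' = ⊥-elim (¬r' refl)
      demoted-cross {true} _ refl _
        rewrite root-of-root F₀ (inj₂ refl) | dec-true (y ≟ᵛ y) refl | +-identityʳ (height F₀ y) =
          root∈ F₀ (inj₂ refl) , m≤n+m _ _
      shared-demoted : SharedRootsDemoted F₀ F₁ (_≡ false ∷ y)
      shared-demoted s₀ s₁ with shared s₀ s₁
      ... | inj₁ refl = false , inj₁ refl , x≢y ∘ ∷-injectiveʳ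
      ... | inj₂ refl = true , refl , λ ()

  join-forest-tree₁ : ∀ {x y r} (F₀ : TwoRootedForest S₀ x y) (F₁ : RootedTree S₁ r)
                    → (∀ {v} → T (S₀ v) → T (S₁ v) → v ≡ x ⊎ v ≡ y) → T (S₁ x) → T (S₁ y)
                    → RootedTree (stack (layers S₀ S₁)) (true ∷ r)
  join-forest-tree₁ {x} {y} {r} F₀ F₁ shared x∈S₁ y∈S₁ =
    glued F₀ F₁ (_≟ᵛ (true ∷ r)) h roots-old lower-in-layer demoted-cross shared-demoted
    where
      h : Vertex (suc n) → ℕ
      h (false ∷ v) = height F₀ v + suc (height F₁ x + height F₁ y)
      h (true ∷ v) = height F₁ v
      roots-old : NewRootsOld F₀ F₁ (_≡ true ∷ r)
      roots-old {true} refl = refl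
      lower-in-layer : LowerInLayer F₀ F₁ h
      lower-in-layer {false} s ¬r = +-monoˡ-< _ (parent-lower F₀ s ¬r)
      lower-in-layer {true} = parent-lower F₁
      demoted-cross : DemotedHangAcross F₀ F₁ (_≡ true ∷ r) h
      demoted-cross {false} _ (inj₁ refl) _ = x∈S₁ , ≤-trans (s≤s (m≤m+n _ _)) (m≤n+m _ _)
      demoted-cross {false} _ (inj₂ refl) _ = y∈S₁ , ≤-trans (s≤s (m≤n+m _ _)) (m≤n+m _ _)
      demoted-cross {true} _ refl ¬r' = ⊥-elim (¬r' refl)
      shared-demoted : SharedRootsDemoted F₀ F₁ (_≡ true ∷ r)
      shared-demoted s₀ s₁ = false , shared s₀ s₁ , λ ()

  disjoint-trees : ∀ {r₀ r₁} (F₀ : RootedTree S₀ r₀) (F₁ : RootedTree S₁ r₁)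
                 → (∀ {v} → T (S₀ v) → ¬ T (S₁ v))
                 → TwoRootedForest (stack (layers S₀ S₁)) (false ∷ r₀) (true ∷ r₁)
  disjoint-trees {r₀} {r₁} F₀ F₁ disjoint =
    glued F₀ F₁ (roots? (false ∷ r₀) (true ∷ r₁)) h roots-old lower-in-layer demoted-cross shared-demoted
    where
      R' : Vertex (suc n) → Set
      R' w = w ≡ false ∷ r₀ ⊎ w ≡ true ∷ r₁
      h : Vertex (suc n) → ℕ
      h (false ∷ v) = height F₀ v
      h (true ∷ v) = height F₁ v
      roots-old : NewRootsOld F₀ F₁ R'
      roots-old {false} (inj₁ refl) = refl
      roots-old {true} (inj₂ refl) = refl
      lower-in-layer : LowerInLayer F₀ F₁ h
      lower-in-layer {false} = parent-lower F₀
      lower-in-layer {true} = parent-lower F₁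
      demoted-cross : DemotedHangAcross F₀ F₁ R' h
      demoted-cross {false} _ refl ¬r' = ⊥-elim (¬r' (inj₁ refl))
      demoted-cross {true} _ refl ¬r' = ⊥-elim (¬r' (inj₂ refl))
      shared-demoted : SharedRootsDemoted F₀ F₁ R'
      shared-demoted s₀ s₁ = ⊥-elim (disjoint s₀ s₁)

class : (Vertex n → Bool) → Bool → VertexSet n
class {n} = colorClass (Q n)

switch : (Vertex n → Bool) → Vertex n → Vertex n → Vertex n → Bool
switch {n} = switch₂ (Q n)

class⇒colour : ∀ (C : Vertex n → Bool) {c} v → T (class C c v) → C v ≡ c
class⇒colour C {c} v t with C v Bool.≟ c
... | yes e = e

colour⇒class : ∀ (C : Vertex n → Bool) {c} v → C v ≡ c → T (class C c v)
colour⇒class C {c} v e with C v Bool.≟ c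
... | yes _ = tt
... | no ne = ne e

class-disjoint : ∀ (C : Vertex n → Bool) c {v} → T (class C c v) → ¬ T (class C (not c) v)
class-disjoint C false {v} t t' = clash (class⇒colour C v t') (class⇒colour C v t)
class-disjoint C true {v} t t' = clash (class⇒colour C v t) (class⇒colour C v t')

class-not : ∀ (C : Vertex n → Bool) c v → class (not ∘ C) c v ≡ class C (not c) v
class-not C c v with C v | c
... | false | false = refl
... | false | true = refl
... | true | false = refl
... | true | true = refl

switch-first : ∀ (C : Vertex n → Bool) a b → switch C a b a ≡ not (C a)
switch-first C a b with a ≟ᵛ a
... | yes _ = refl
... | no a≢a = ⊥-elim (a≢a refl)

switch-second : ∀ (C : Vertex n → Bool) {a b} → a ≢ b → switch C a b b ≡ not (C b)
switch-second C {a} {b} a≢b with b ≟ᵛ a | b ≟ᵛ b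
... | yes b≡a | _ = ⊥-elim (a≢b (sym b≡a))
... | no _ | yes _ = refl
... | no _ | no b≢b = ⊥-elim (b≢b refl)

switch-other : ∀ (C : Vertex n → Bool) a b {v} → v ≢ a → v ≢ b → switch C a b v ≡ C v
switch-other C a b {v} v≢a v≢b with v ≟ᵛ a | v ≟ᵛ b
... | yes v≡a | _ = ⊥-elim (v≢a v≡a)
... | no _ | yes v≡b = ⊥-elim (v≢b v≡b)
... | no _ | no _ = refl

switch-changed : ∀ (C : Vertex n → Bool) a b {v} → switch C a b v ≢ C v → v ≡ a ⊎ v ≡ b
switch-changed C a b {v} changed with v ≟ᵛ a | v ≟ᵛ b
... | yes v≡a | _ = inj₁ v≡a
... | no _ | yes v≡b = inj₂ v≡b
... | no _ | no _ = ⊥-elim (changed refl)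

switch-not-switch : ∀ (C : Vertex n → Bool) a b v → switch (not ∘ switch C a b) a b v ≡ not (C v)
switch-not-switch C a b v with v ≟ᵛ a
... | yes _ = cong not (Bool.not-involutive (C v))
... | no _ with v ≟ᵛ b
...   | yes _ = cong not (Bool.not-involutive (C v))
...   | no _ = refl

switch-as-xor : ∀ (C : Vertex n → Bool) a b v → switch C a b v ≡ C v xor (does (v ≟ᵛ a) ∨ does (v ≟ᵛ b))
switch-as-xor C a b v with v ≟ᵛ a | v ≟ᵛ b | C v
... | yes _ | _ | false = refl
... | yes _ | _ | true = refl
... | no _ | yes _ | false = refl
... | no _ | yes _ | true = refl
... | no _ | no _ | false = refl
... | no _ | no _ | true = refl

card-suc : ∀ (D : Vertex (suc n) → Vertex (suc n) → Bool)
  → card (Q (suc n)) D ≡ card (Q n) (λ u v → D (false ∷ u) (false ∷ v)) + card (Q n) (λ u v → D (true ∷ u) (true ∷ v))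
                        + count (λ p → D (false ∷ proj₁ p) (true ∷ proj₂ p)) (cartesianProduct (allVecs n) (allVecs n))
card-suc {n} D =
  trans (count-pairs-++ D′ (map (false ∷_) V) (map (true ∷_) V))
        (cong₂ _+_ (cong₂ _+_ (image (pairs-map (false ∷_) V)) (image (pairs-map (true ∷_) V)))
                   (image (cartesianProduct-map (false ∷_) (true ∷_) V V)))
  where
    V : List (Vertex n)
    V = allVecs n
    D′ : Vertex (suc n) × Vertex (suc n) → Bool
    D′ p = D (proj₁ p) (proj₂ p)
    image : ∀ {A : Set} {xs : List (Vertex (suc n) × Vertex (suc n))} {f : A → Vertex (suc n) × Vertex (suc n)} {ys}
          → xs ≡ map f ys → count D′ xs ≡ count (D′ ∘ f) ys
    image {f = f} {ys} refl = count-map D′ f ys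

count-allVecs-suc : ∀ (P : Vertex (suc n) → Bool)
  → count P (allVecs (suc n)) ≡ count (P ∘ (false ∷_)) (allVecs n) + count (P ∘ (true ∷_)) (allVecs n)
count-allVecs-suc {n} P =
  trans (count-++ P (map (false ∷_) (allVecs n)) _) (cong₂ _+_ (count-map P _ (allVecs n)) (count-map P _ (allVecs n)))

count-diagonal : ∀ (u : Vertex n) (W : Vertex n → Bool)
               → count (λ v → (hamming u v ≡ᵇ 0) ∧ W v) (allVecs n) ≡ (if W u then 1 else 0)
count-diagonal [] W with W []
... | true = refl
... | false = refl
count-diagonal {suc n} (false ∷ u) W =
  trans (count-allVecs-suc (λ v → (hamming (false ∷ u) v ≡ᵇ 0) ∧ W v))
        (trans (cong₂ _+_ (count-diagonal u (W ∘ (false ∷_))) (count-false (allVecs n))) (+-identityʳ _))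
count-diagonal {suc n} (true ∷ u) W =
  trans (count-allVecs-suc (λ v → (hamming (true ∷ u) v ≡ᵇ 0) ∧ W v))
        (cong₂ _+_ (count-false (allVecs n)) (count-diagonal u (W ∘ (true ∷_))))

count-cartesianProduct-diagonal : ∀ (W : Vertex n → Vertex n → Bool) xs
  → count (λ p → (hamming (proj₁ p) (proj₂ p) ≡ᵇ 0) ∧ W (proj₁ p) (proj₂ p)) (cartesianProduct xs (allVecs n))
    ≡ count (λ u → W u u) xs
count-cartesianProduct-diagonal W [] = refl
count-cartesianProduct-diagonal {n} W (x ∷ xs) = begin
  count _ (map (x ,_) (allVecs n) ++ cartesianProduct xs (allVecs n))
    ≡⟨ count-++ _ (map (x ,_) (allVecs n)) _ ⟩
  count _ (map (x ,_) (allVecs n)) + count _ (cartesianProduct xs (allVecs n))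
    ≡⟨ cong₂ _+_ (trans (count-map _ (x ,_) (allVecs n)) (count-diagonal x (W x)))
                 (count-cartesianProduct-diagonal W xs) ⟩
  (if W x x then 1 else 0) + count (λ u → W u u) xs
    ≡⟨ cons (W x x) refl ⟩
  count (λ u → W u u) (x ∷ xs) ∎
  where
    open ≡-Reasoning
    cons : ∀ b → W x x ≡ b → (if b then 1 else 0) + count (λ u → W u u) xs ≡ count (λ u → W u u) (x ∷ xs)
    cons true e rewrite e = refl
    cons false e rewrite e = refl

order-suc : order (Q (suc n)) ≡ order (Q n) + order (Q n)
order-suc {n} = trans (length-++ (map (false ∷_) (allVecs n))) (cong₂ _+_ (length-map _ (allVecs n)) (length-map _ (allVecs n)))

size-suc : size (Q (suc n)) ≡ size (Q n) + size (Q n) + order (Q n)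
size-suc {n} = trans (card-suc (Graph.adj (Q (suc n)))) (cong (size (Q n) + size (Q n) +_) (begin
  count (λ p → hamming (proj₁ p) (proj₂ p) ≡ᵇ 0) V×V
    ≡⟨ count-cong (λ p → sym (Bool.∧-identityʳ _)) V×V ⟩
  count (λ p → (hamming (proj₁ p) (proj₂ p) ≡ᵇ 0) ∧ true) V×V
    ≡⟨ count-cartesianProduct-diagonal (λ _ _ → true) (allVecs n) ⟩
  count (λ _ → true) (allVecs n)
    ≡⟨ count-true (allVecs n) ⟩
  order (Q n) ∎))
  where
    open ≡-Reasoning
    V×V : List (Vertex n × Vertex n)
    V×V = cartesianProduct (allVecs n) (allVecs n)

count-singleton : ∀ (a : Vertex n) → count (λ v → does (v ≟ᵛ a)) (allVecs n) ≡ 1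
count-singleton [] = refl
count-singleton {suc n} (false ∷ a) =
  trans (count-allVecs-suc (λ v → does (v ≟ᵛ (false ∷ a)))) (cong₂ _+_ (count-singleton a) (count-false (allVecs n)))
count-singleton {suc n} (true ∷ a) =
  trans (count-allVecs-suc (λ v → does (v ≟ᵛ (true ∷ a)))) (cong₂ _+_ (count-false (allVecs n)) (count-singleton a))

cut : (Vertex n → Bool) → Vertex n → Vertex n → Bool
cut {n} C u v = Graph.adj (Q n) u v ∧ (C u xor C v)

cutSize : (Vertex n → Bool) → ℕ
cutSize {n} C = card (Q n) (cut C)

cutSize-stack : ∀ (X₀ X₁ : Vertex n → Bool)
  → cutSize (stack (layers X₀ X₁)) ≡ cutSize X₀ + cutSize X₁ + count (λ v → X₀ v xor X₁ v) (allVecs n)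
cutSize-stack {n} X₀ X₁ = trans (card-suc (cut (stack (layers X₀ X₁))))
  (cong (cutSize X₀ + cutSize X₁ +_) (count-cartesianProduct-diagonal (λ u v → X₀ u xor X₁ v) (allVecs n)))

cutSize-cong : ∀ {X Y : Vertex n → Bool} → X ≗ Y → cutSize X ≡ cutSize Y
cutSize-cong {n} X≗Y = count-cong (λ p → cong₂ (λ a b → Graph.adj (Q n) (proj₁ p) (proj₂ p) ∧ (a xor b)) (X≗Y (proj₁ p)) (X≗Y (proj₂ p))) (pairs (allVecs n))

cutSize-complement : ∀ (X : Vertex n → Bool) → cutSize (not ∘ X) ≡ cutSize X
cutSize-complement {n} X =
  count-cong (λ p → cong (Graph.adj (Q n) (proj₁ p) (proj₂ p) ∧_) (Bool.xor-annihilates-not (X (proj₁ p)) (X (proj₂ p)))) (pairs (allVecs n))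

module _ (C : Vertex n → Bool) (hamiltonian : IsHamiltonianColoring (Q n) C) where

  private
    Avoiding : (Vertex n → Vertex n → Bool) → Vertex n → Vertex n → Set
    Avoiding = Reach (Q n)

    class-connected : ∀ c {u v} → C u ≡ c → C v ≡ c → Reaches (class C c) u v
    class-connected true {u} {v} cu cv =
      proj₁ (proj₂ (proj₁ hamiltonian)) u v (∈-allVecs u) (∈-allVecs v) (colour⇒class C u cu) (colour⇒class C v cv)
    class-connected false {u} {v} cu cv =
      proj₁ (proj₂ (proj₂ hamiltonian)) u v (∈-allVecs u) (∈-allVecs v) (colour⇒class C u cu) (colour⇒class C v cv)

    Avoiding-trans : ∀ {D u v w} → Avoiding D u v → Avoiding D v w → Avoiding D u w
    Avoiding-trans here q = q
    Avoiding-trans (step a d p) q = step a d (Avoiding-trans p q)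

    Avoiding-sym : ∀ {D} → (∀ u v → D u v ≡ D v u) → ∀ {u v} → Avoiding D u v → Avoiding D v u
    Avoiding-sym D-sym here = here
    Avoiding-sym D-sym {u} (step {w = w} a d p) =
      Avoiding-trans (Avoiding-sym D-sym p) (step (Adjacent-sym u w a) (subst (T ∘ not) (D-sym u w) d) here)

    cut⇒adjacent : ∀ {u v} → T (cut C u v) → Adjacent u v
    cut⇒adjacent t = proj₁ (Equivalence.to Bool.T-∧ t)

    cut⇒colours-differ : ∀ {u v} → T (cut C u v) → C u ≢ C v
    cut⇒colours-differ {u} t e =
      subst T (trans (cong (C u xor_) (sym e)) (Bool.xor-same (C u))) (proj₂ (Equivalence.to Bool.T-∧ t))

    same-colour-across : ∀ {u v} → T (not (cut C u v)) → Adjacent u v → C u ≡ C v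
    same-colour-across {u} {v} d a with Graph.adj (Q n) u v | C u | C v
    ... | true | false | false = refl
    ... | true | true | true = refl

    Avoiding-cut⇒same-colour : ∀ {u v} → Avoiding (cut C) u v → C u ≡ C v
    Avoiding-cut⇒same-colour here = refl
    Avoiding-cut⇒same-colour (step a d p) = trans (same-colour-across d a) (Avoiding-cut⇒same-colour p)

    cut-isEdgeSet : IsEdgeSet (Q n) (cut C)
    cut-isEdgeSet = (λ u v → cong₂ _∧_ (adj-sym u v) (Bool.xor-comm (C u) (C v))) , (λ u v → cut⇒adjacent)
      where
        adj-sym : ∀ u v → Graph.adj (Q n) u v ≡ Graph.adj (Q n) v u
        adj-sym u v = cong (_≡ᵇ 1) (hamming-sym u v)

    cut-disconnects : Disconnects (Q n) (cut C)
    cut-disconnects with proj₁ (proj₁ hamiltonian) | proj₁ (proj₂ hamiltonian)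
    ... | (u , u∈ , cu) | (v , v∈ , cv) =
      u , v , u∈ , v∈ , λ p → clash (trans (sym (Avoiding-cut⇒same-colour p)) (class⇒colour C u cu)) (class⇒colour C v cv)

    -- Inside a colour class no edge is cut, so any D' ⊆ cut C misses all of them.
    cut-minimal : ∀ D' → IsEdgeSet (Q n) D' → _⊆E_ (Q n) D' (cut C) → Disconnects (Q n) D' → _⊆E_ (Q n) (cut C) D'
    cut-minimal D' (D'-sym , _) D'⊆cut (x , y , _ , _ , x↛y) u v uv∈cut with T? (D' u v)
    ... | yes d = d
    ... | no ¬d = ⊥-elim (x↛y (Avoiding-trans (to-u x) (Avoiding-sym D'-sym (to-u y))))
      where
        within : ∀ c {a b} → Reaches (class C c) a b → Avoiding D' a b
        within c (here _) = here
        within c {a} (step {w = w} s adj p) = step adj (¬T⇒T-not (λ d → cut⇒colours-differ (D'⊆cut a w d) same)) (within c p)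
          where
            same : C a ≡ C w
            same = trans (class⇒colour C a s) (sym (class⇒colour C w (Reaches-start p)))
        v-to-u : Avoiding D' v u
        v-to-u = step (Adjacent-sym u v (cut⇒adjacent uv∈cut)) (subst (T ∘ not) (D'-sym u v) (¬T⇒T-not ¬d)) here
        to-u : ∀ z → Avoiding D' z u
        to-u z with C z Bool.≟ C u
        ... | yes e = within (C u) (class-connected (C u) {z} {u} e refl)
        ... | no ne = Avoiding-trans (within (C v) (class-connected (C v) {z} {v} Cz≡Cv refl)) v-to-u
          where
            Cz≡Cv : C z ≡ C v
            Cz≡Cv = trans (≢⇒≡not (ne ∘ sym)) (sym (≢⇒≡not (cut⇒colours-differ uv∈cut)))

  cut-isBond : IsBond (Q n) (cut C)
  cut-isBond = cut-isEdgeSet , cut-disconnects , cut-minimal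

-- The surplus d of a colouring X is given by cutSize X + |V| ≡ ‖E‖ + d. Stacking
-- doubles |V| and turns ‖E‖ into 2‖E‖ + |V|, so the surplus of a stack is the sum
-- of the surpluses of its layers minus the number of vertical edges left uncut.
stack-surplus : ∀ (X₀ X₁ : Vertex n → Bool) {d₀ d₁ d}
  → cutSize X₀ + order (Q n) ≡ size (Q n) + d₀ → cutSize X₁ + order (Q n) ≡ size (Q n) + d₁
  → count (λ v → X₀ v xor X₁ v) (allVecs n) + (d₀ + d₁) ≡ order (Q n) + d
  → cutSize (stack (layers X₀ X₁)) + order (Q (suc n)) ≡ size (Q (suc n)) + d
stack-surplus {n} X₀ X₁ {d₀} {d₁} {d} h₀ h₁ hk = +-cancelʳ-≡ (d₀ + d₁) _ _ (begin
  cutSize (stack (layers X₀ X₁)) + order (Q (suc n)) + (d₀ + d₁)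
    ≡⟨ cong₂ (λ c o → c + o + (d₀ + d₁)) (cutSize-stack X₀ X₁) (order-suc {n}) ⟩
  (x + y + k) + (V + V) + (d₀ + d₁)      ≡⟨ regroupˡ x y k V (d₀ + d₁) ⟩
  (x + V) + (y + V) + (k + (d₀ + d₁))    ≡⟨ cong₂ _+_ (cong₂ _+_ h₀ h₁) hk ⟩
  (E + d₀) + (E + d₁) + (V + d)          ≡⟨ regroupʳ E V d₀ d₁ d ⟩
  (E + E + V) + d + (d₀ + d₁)            ≡⟨ cong (λ e → e + d + (d₀ + d₁)) (size-suc {n}) ⟨
  size (Q (suc n)) + d + (d₀ + d₁)       ∎)
  where
    open ≡-Reasoning
    x y k V E : ℕ
    x = cutSize X₀
    y = cutSize X₁
    k = count (λ v → X₀ v xor X₁ v) (allVecs n)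
    V = order (Q n)
    E = size (Q n)
    regroupˡ : ∀ x y k V e → (x + y + k) + (V + V) + e ≡ (x + V) + (y + V) + (k + e)
    regroupˡ = solve-∀
    regroupʳ : ∀ E V d₁ d₂ d → (E + d₁) + (E + d₂) + (V + d) ≡ (E + E + V) + d + (d₁ + d₂)
    regroupʳ = solve-∀

cut-isHamiltonianBond : ∀ (C : Vertex n → Bool) → IsHamiltonianColoring (Q n) C
  → cutSize C + order (Q n) ≡ size (Q n) + 2 → DualHamiltonian (Q n)
cut-isHamiltonianBond C hamiltonian surplus = cut C , cut-isBond C hamiltonian , surplus

-- A colouring C with the quartet (I, J) = ({a₁, a₂}, {b₁, b₂}): the classes of C and
-- C Δ I as trees and those of C Δ J as two-component forests, rooted at each point
-- where the induction step glues them.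
record CertifiedQuartet (n : ℕ) : Set where
  field
    C : Vertex n → Bool
    a₁ a₂ b₁ b₂ : Vertex n
    C-a₁ : C a₁ ≡ true
    C-a₂ : C a₂ ≡ false
    C-b₁ : C b₁ ≡ true
    C-b₂ : C b₂ ≡ false
    a₁≢b₁ : a₁ ≢ b₁
    a₁≢b₂ : a₁ ≢ b₂
    a₂≢b₁ : a₂ ≢ b₁
    a₂≢b₂ : a₂ ≢ b₂
    C-tree-a₁ : RootedTree (class C true) a₁
    C-tree-b₁ : RootedTree (class C true) b₁
    C-tree-a₂ : RootedTree (class C false) a₂
    C-tree-b₂ : RootedTree (class C false) b₂
    CI-tree-a₁ : RootedTree (class (switch C a₁ a₂) false) a₁
    CI-tree-b₂ : RootedTree (class (switch C a₁ a₂) false) b₂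
    CI-tree-a₂ : RootedTree (class (switch C a₁ a₂) true) a₂
    CI-tree-b₁ : RootedTree (class (switch C a₁ a₂) true) b₁
    CJ-forest-true : TwoRootedForest (class (switch C b₁ b₂) true) a₁ b₂
    CJ-forest-false : TwoRootedForest (class (switch C b₁ b₂) false) a₂ b₁

module CertifiedQuartetProperties {n : ℕ} (K : CertifiedQuartet n) where
  open CertifiedQuartet K

  CI CJ : Vertex n → Bool
  CI = switch C a₁ a₂
  CJ = switch C b₁ b₂

  a₁≢a₂ : a₁ ≢ a₂
  a₁≢a₂ refl = clash C-a₁ C-a₂

  b₁≢b₂ : b₁ ≢ b₂
  b₁≢b₂ refl = clash C-b₁ C-b₂

  CI-a₁ : CI a₁ ≡ false
  CI-a₁ = trans (switch-first C a₁ a₂) (cong not C-a₁)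

  CI-a₂ : CI a₂ ≡ true
  CI-a₂ = trans (switch-second C a₁≢a₂) (cong not C-a₂)

  CI-b₁ : CI b₁ ≡ true
  CI-b₁ = trans (switch-other C a₁ a₂ (a₁≢b₁ ∘ sym) (a₂≢b₁ ∘ sym)) C-b₁

  CI-b₂ : CI b₂ ≡ false
  CI-b₂ = trans (switch-other C a₁ a₂ (a₁≢b₂ ∘ sym) (a₂≢b₂ ∘ sym)) C-b₂

  CJ-b₁ : CJ b₁ ≡ false
  CJ-b₁ = trans (switch-first C b₁ b₂) (cong not C-b₁)

  CJ-b₂ : CJ b₂ ≡ true
  CJ-b₂ = trans (switch-second C b₁≢b₂) (cong not C-b₂)

  CJ≢CI⇒∈I∪J : ∀ {v} → CJ v ≢ CI v → (v ≡ a₁ ⊎ v ≡ a₂) ⊎ (v ≡ b₁ ⊎ v ≡ b₂)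
  CJ≢CI⇒∈I∪J {v} CJ≢CI with CJ v Bool.≟ C v
  ... | yes CJ≡C = inj₁ (switch-changed C a₁ a₂ (λ CI≡C → CJ≢CI (trans CJ≡C (sym CI≡C))))
  ... | no CJ≢C = inj₂ (switch-changed C b₁ b₂ CJ≢C)

  shared-C-CI-true : ∀ {v} → T (class C true v) → T (class CI false v) → v ≡ a₁
  shared-C-CI-true {v} s s' with switch-changed C a₁ a₂ {v} (λ e → clash (trans e (class⇒colour C v s)) (class⇒colour CI v s'))
  ... | inj₁ v≡a₁ = v≡a₁
  ... | inj₂ refl = ⊥-elim (clash (class⇒colour C a₂ s) C-a₂)

  shared-C-CI-false : ∀ {v} → T (class C false v) → T (class CI true v) → v ≡ a₂
  shared-C-CI-false {v} s s' with switch-changed C a₁ a₂ {v} (λ e → clash (trans (sym e) (class⇒colour CI v s')) (class⇒colour C v s))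
  ... | inj₁ refl = ⊥-elim (clash C-a₁ (class⇒colour C a₁ s))
  ... | inj₂ v≡a₂ = v≡a₂

  shared-CJ-CI-true : ∀ {v} → T (class CJ true v) → T (class CI false v) → v ≡ a₁ ⊎ v ≡ b₂
  shared-CJ-CI-true {v} s s' with CJ≢CI⇒∈I∪J {v} (λ e → clash (trans (sym e) (class⇒colour CJ v s)) (class⇒colour CI v s'))
  ... | inj₁ (inj₁ v≡a₁) = inj₁ v≡a₁
  ... | inj₁ (inj₂ refl) = ⊥-elim (clash CI-a₂ (class⇒colour CI a₂ s'))
  ... | inj₂ (inj₁ refl) = ⊥-elim (clash (class⇒colour CJ b₁ s) CJ-b₁)
  ... | inj₂ (inj₂ v≡b₂) = inj₂ v≡b₂

  shared-CJ-CI-false : ∀ {v} → T (class CJ false v) → T (class CI true v) → v ≡ a₂ ⊎ v ≡ b₁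
  shared-CJ-CI-false {v} s s' with CJ≢CI⇒∈I∪J {v} (λ e → clash (trans e (class⇒colour CI v s')) (class⇒colour CJ v s))
  ... | inj₁ (inj₁ refl) = ⊥-elim (clash (class⇒colour CI a₁ s') CI-a₁)
  ... | inj₁ (inj₂ v≡a₂) = inj₁ v≡a₂
  ... | inj₂ (inj₁ v≡b₁) = inj₂ v≡b₁
  ... | inj₂ (inj₂ refl) = ⊥-elim (clash CJ-b₂ (class⇒colour CJ b₂ s))

  C' : Vertex (suc n) → Bool
  C' = stack (layers C (not ∘ CI))

  C'-class : ∀ c → stack (layers (class C c) (class CI (not c))) ≗ class C' c
  C'-class c (false ∷ v) = refl
  C'-class c (true ∷ v) = sym (class-not CI c v)

  C'I-class : ∀ c → stack (layers (class CJ c) (class CI (not c))) ≗ class (switch C' (false ∷ b₁) (false ∷ b₂)) c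
  C'I-class c (false ∷ v) = refl
  C'I-class c (true ∷ v) = sym (class-not CI c v)

  C'J-class : ∀ c → stack (layers (class C c) (class C (not c))) ≗ class (switch C' (true ∷ a₁) (true ∷ a₂)) c
  C'J-class c (false ∷ v) = refl
  C'J-class c (true ∷ v) = sym (begin
    class (switch (not ∘ CI) a₁ a₂) c v  ≡⟨ cong (λ b → does (b Bool.≟ c)) (switch-not-switch C a₁ a₂ v) ⟩
    class (not ∘ C) c v                  ≡⟨ class-not C c v ⟩
    class C (not c) v                    ∎)
    where open ≡-Reasoning

  a₁∈CI-false : T (class CI false a₁)
  a₁∈CI-false = colour⇒class CI a₁ CI-a₁

  a₂∈CI-true : T (class CI true a₂)
  a₂∈CI-true = colour⇒class CI a₂ CI-a₂

  extend : CertifiedQuartet (suc n)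
  extend = record
    { C = C'
    ; a₁ = false ∷ b₁
    ; a₂ = false ∷ b₂
    ; b₁ = true ∷ a₁
    ; b₂ = true ∷ a₂
    ; C-a₁ = C-b₁
    ; C-a₂ = C-b₂
    ; C-b₁ = cong not CI-a₁
    ; C-b₂ = cong not CI-a₂
    ; a₁≢b₁ = λ ()
    ; a₁≢b₂ = λ ()
    ; a₂≢b₁ = λ ()
    ; a₂≢b₂ = λ ()
    ; C-tree-a₁ = RootedForest-resp (C'-class true)
        (join-trees₀ C-tree-b₁ CI-tree-a₁ shared-C-CI-true (colour⇒class C a₁ C-a₁))
    ; C-tree-b₁ = RootedForest-resp (C'-class true)
        (join-trees₁ C-tree-a₁ CI-tree-a₁ shared-C-CI-true a₁∈CI-false)
    ; C-tree-a₂ = RootedForest-resp (C'-class false)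
        (join-trees₀ C-tree-b₂ CI-tree-a₂ shared-C-CI-false (colour⇒class C a₂ C-a₂))
    ; C-tree-b₂ = RootedForest-resp (C'-class false)
        (join-trees₁ C-tree-a₂ CI-tree-a₂ shared-C-CI-false a₂∈CI-true)
    ; CI-tree-a₁ = RootedForest-resp (C'I-class false)
        (join-forest-tree₀ CJ-forest-false CI-tree-b₁ a₂≢b₁ shared-CJ-CI-false a₂∈CI-true)
    ; CI-tree-b₂ = RootedForest-resp (C'I-class false)
        (join-forest-tree₁ CJ-forest-false CI-tree-a₂ shared-CJ-CI-false a₂∈CI-true (colour⇒class CI b₁ CI-b₁))
    ; CI-tree-a₂ = RootedForest-resp (C'I-class true)
        (join-forest-tree₀ CJ-forest-true CI-tree-b₂ a₁≢b₂ shared-CJ-CI-true a₁∈CI-false)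
    ; CI-tree-b₁ = RootedForest-resp (C'I-class true)
        (join-forest-tree₁ CJ-forest-true CI-tree-a₁ shared-CJ-CI-true a₁∈CI-false (colour⇒class CI b₂ CI-b₂))
    ; CJ-forest-true = RootedForest-resp (C'J-class true)
        (disjoint-trees C-tree-b₁ C-tree-a₂ (class-disjoint C true))
    ; CJ-forest-false = RootedForest-resp (C'J-class false)
        (disjoint-trees C-tree-b₂ C-tree-a₁ (class-disjoint C false))
    }

  isHamiltonian : IsHamiltonianColoring (Q n) C
  isHamiltonian = RootedTree⇒IsTree C-tree-a₁ , RootedTree⇒IsTree C-tree-a₂

  isQuartet : IsQuartet (Q n) C a₁ a₂ b₁ b₂
  isQuartet =
    (∈-allVecs a₁ , ∈-allVecs a₂ , ∈-allVecs b₁ , ∈-allVecs b₂)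
    , (a₁≢a₂ , b₁≢b₂ , a₁≢b₁ , a₁≢b₂ , a₂≢b₁ , a₂≢b₂)
    , ((λ e → clash (trans (sym e) C-a₁) C-a₂) , (λ e → clash (trans (sym e) C-b₁) C-b₂))
    , (RootedTree⇒IsTree CI-tree-a₂ , RootedTree⇒IsTree CI-tree-a₁)
    , λ { true → let forest , rest = TwoRootedForest⇒components CJ-forest-true a₁≢b₂
                 in forest , a₁ , b₂ , inj₁ refl , inj₂ refl , rest
        ; false → let forest , rest = TwoRootedForest⇒components CJ-forest-false a₂≢b₁
                  in forest , a₂ , b₁ , inj₂ refl , inj₁ refl , rest }

xor-not-xor : ∀ c i → c xor not (c xor i) ≡ not i
xor-not-xor false i = refl
xor-not-xor true i = Bool.not-involutive (not i)

xor-xor-not-xor : ∀ c i j → T (not (i ∧ j)) → (c xor j) xor not (c xor i) ≡ not (i ∨ j)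
xor-xor-not-xor false false false _ = refl
xor-xor-not-xor false false true _ = refl
xor-xor-not-xor false true false _ = refl
xor-xor-not-xor true false false _ = refl
xor-xor-not-xor true false true _ = refl
xor-xor-not-xor true true false _ = refl

-- When the colour classes are forests, the surplus is their number of components.
record CutSizes {n : ℕ} (K : CertifiedQuartet n) : Set where
  open CertifiedQuartet K
  field
    C-surplus : cutSize C + order (Q n) ≡ size (Q n) + 2
    CI-surplus : cutSize (switch C a₁ a₂) + order (Q n) ≡ size (Q n) + 2
    CJ-surplus : cutSize (switch C b₁ b₂) + order (Q n) ≡ size (Q n) + 4

module _ {n : ℕ} {K : CertifiedQuartet n} (sizes : CutSizes K) where
  open CertifiedQuartet K
  open CertifiedQuartetProperties K
  open CutSizes sizes

  private
    V E : ℕ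
    V = order (Q n)
    E = size (Q n)

    inI inJ : Vertex n → Bool
    inI v = does (v ≟ᵛ a₁) ∨ does (v ≟ᵛ a₂)
    inJ v = does (v ≟ᵛ b₁) ∨ does (v ≟ᵛ b₂)

    distinct-singletons : ∀ {a b : Vertex n} → a ≢ b → ∀ v → T (does (v ≟ᵛ a)) → ¬ T (does (v ≟ᵛ b))
    distinct-singletons {a} {b} a≢b v t t' = a≢b (trans (sym (does⇒≡ v a t)) (does⇒≡ v b t'))

    count-pair : ∀ {a b : Vertex n} → a ≢ b → count (λ v → does (v ≟ᵛ a) ∨ does (v ≟ᵛ b)) (allVecs n) ≡ 2
    count-pair {a} {b} a≢b =
      trans (count-∨ _ _ (distinct-singletons a≢b) (allVecs n)) (cong₂ _+_ (count-singleton a) (count-singleton b))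

    I∩J-empty : ∀ v → T (inI v) → ¬ T (inJ v)
    I∩J-empty v i j with Equivalence.to Bool.T-∨ i | Equivalence.to Bool.T-∨ j
    ... | inj₁ x | inj₁ y = distinct-singletons a₁≢b₁ v x y
    ... | inj₁ x | inj₂ y = distinct-singletons a₁≢b₂ v x y
    ... | inj₂ x | inj₁ y = distinct-singletons a₂≢b₁ v x y
    ... | inj₂ x | inj₂ y = distinct-singletons a₂≢b₂ v x y

    C'-vertical-cut : count (λ v → C v xor not (CI v)) (allVecs n) + 2 ≡ V
    C'-vertical-cut = begin
      count (λ v → C v xor not (CI v)) (allVecs n) + 2
        ≡⟨ cong₂ _+_ (count-cong (λ v → trans (cong (λ b → C v xor not b) (switch-as-xor C a₁ a₂ v)) (xor-not-xor (C v) (inI v))) (allVecs n))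
                     (sym (count-pair a₁≢a₂)) ⟩
      count (not ∘ inI) (allVecs n) + count inI (allVecs n)
        ≡⟨ +-comm _ (count inI (allVecs n)) ⟩
      count inI (allVecs n) + count (not ∘ inI) (allVecs n)
        ≡⟨ count-complement inI (allVecs n) ⟩
      V ∎
      where open ≡-Reasoning

    C'I-vertical-cut : count (λ v → CJ v xor not (CI v)) (allVecs n) + 4 ≡ V
    C'I-vertical-cut = begin
      count (λ v → CJ v xor not (CI v)) (allVecs n) + 4
        ≡⟨ cong₂ _+_ (count-cong agree (allVecs n))
                     (sym (trans (count-∨ inI inJ I∩J-empty (allVecs n)) (cong₂ _+_ (count-pair a₁≢a₂) (count-pair b₁≢b₂)))) ⟩
      count (not ∘ I∪J) (allVecs n) + count I∪J (allVecs n)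
        ≡⟨ +-comm _ (count I∪J (allVecs n)) ⟩
      count I∪J (allVecs n) + count (not ∘ I∪J) (allVecs n)
        ≡⟨ count-complement I∪J (allVecs n) ⟩
      V ∎
      where
        open ≡-Reasoning
        I∪J : Vertex n → Bool
        I∪J v = inI v ∨ inJ v
        agree : ∀ v → CJ v xor not (CI v) ≡ not (I∪J v)
        agree v = trans (cong₂ (λ x y → x xor not y) (switch-as-xor C b₁ b₂ v) (switch-as-xor C a₁ a₂ v))
                        (xor-xor-not-xor (C v) (inI v) (inJ v) (¬T⇒T-not (λ t → uncurry (I∩J-empty v) (Equivalence.to Bool.T-∧ t))))

  extend-cutSizes : CutSizes extend
  extend-cutSizes = record
    { C-surplus = stack-surplus C (not ∘ CI) C-surplus CI-complement-surplus
        (trans (sym (+-assoc _ 2 2)) (cong (_+ 2) C'-vertical-cut))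
    ; CI-surplus = trans (cong (_+ _) (cutSize-cong CI'≗)) (stack-surplus CJ (not ∘ CI) CJ-surplus CI-complement-surplus
        (trans (sym (+-assoc _ 4 2)) (cong (_+ 2) C'I-vertical-cut)))
    ; CJ-surplus = trans (cong (_+ _) (cutSize-cong CJ'≗)) (stack-surplus C (not ∘ C) C-surplus
        (trans (cong (_+ V) (cutSize-complement C)) C-surplus)
        (cong (_+ 4) (trans (count-cong (λ v → Bool.xor-inverseʳ (C v)) (allVecs n)) (count-true (allVecs n)))))
    }
    where
      CI-complement-surplus : cutSize (not ∘ CI) + V ≡ E + 2
      CI-complement-surplus = trans (cong (_+ V) (cutSize-complement CI)) CI-surplus
      CI'≗ : switch C' (false ∷ b₁) (false ∷ b₂) ≗ stack (layers CJ (not ∘ CI))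
      CI'≗ (false ∷ v) = refl
      CI'≗ (true ∷ v) = refl
      CJ'≗ : switch C' (true ∷ a₁) (true ∷ a₂) ≗ stack (layers C (not ∘ C))
      CJ'≗ (false ∷ v) = refl
      CJ'≗ (true ∷ v) = switch-not-switch C a₁ a₂ v

v₀₀₀ v₀₀₁ v₀₁₀ v₀₁₁ v₁₀₀ v₁₀₁ v₁₁₀ v₁₁₁ : Vertex 3
v₀₀₀ = false ∷ false ∷ false ∷ []
v₀₀₁ = false ∷ false ∷ true ∷ []
v₀₁₀ = false ∷ true ∷ false ∷ []
v₀₁₁ = false ∷ true ∷ true ∷ []
v₁₀₀ = true ∷ false ∷ false ∷ []
v₁₀₁ = true ∷ false ∷ true ∷ []
v₁₁₀ = true ∷ true ∷ false ∷ []
v₁₁₁ = true ∷ true ∷ true ∷ []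

-- Both colour classes are stars: the vertices of weight at most 1 around v₀₀₀,
-- the others around v₁₁₁.
C₃ : Vertex 3 → Bool
C₃ v = hamming v v₀₀₀ ≤ᵇ 1

quartet₃ : CertifiedQuartet 3
quartet₃ = record
  { C = C₃
  ; a₁ = v₀₀₁
  ; a₂ = v₀₁₁
  ; b₁ = v₀₀₀
  ; b₂ = v₁₁₀
  ; C-a₁ = refl
  ; C-a₂ = refl
  ; C-b₁ = refl
  ; C-b₂ = refl
  ; a₁≢b₁ = λ ()
  ; a₁≢b₂ = λ ()
  ; a₂≢b₁ = λ ()
  ; a₂≢b₂ = λ ()
  ; C-tree-a₁ = forestFrom _ (_≟ᵛ v₀₀₁) ((v₀₀₀ , v₀₀₁) ∷ (v₀₁₀ , v₀₀₀) ∷ (v₁₀₀ , v₀₀₀) ∷ [])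
  ; C-tree-b₁ = forestFrom _ (_≟ᵛ v₀₀₀) ((v₀₀₁ , v₀₀₀) ∷ (v₀₁₀ , v₀₀₀) ∷ (v₁₀₀ , v₀₀₀) ∷ [])
  ; C-tree-a₂ = forestFrom _ (_≟ᵛ v₀₁₁) ((v₁₁₁ , v₀₁₁) ∷ (v₁₀₁ , v₁₁₁) ∷ (v₁₁₀ , v₁₁₁) ∷ [])
  ; C-tree-b₂ = forestFrom _ (_≟ᵛ v₁₁₀) ((v₁₁₁ , v₁₁₀) ∷ (v₀₁₁ , v₁₁₁) ∷ (v₁₀₁ , v₁₁₁) ∷ [])
  ; CI-tree-a₁ = forestFrom _ (_≟ᵛ v₀₀₁) ((v₁₀₁ , v₀₀₁) ∷ (v₁₁₁ , v₁₀₁) ∷ (v₁₁₀ , v₁₁₁) ∷ [])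
  ; CI-tree-b₂ = forestFrom _ (_≟ᵛ v₁₁₀) ((v₁₁₁ , v₁₁₀) ∷ (v₁₀₁ , v₁₁₁) ∷ (v₀₀₁ , v₁₀₁) ∷ [])
  ; CI-tree-a₂ = forestFrom _ (_≟ᵛ v₀₁₁) ((v₀₁₀ , v₀₁₁) ∷ (v₀₀₀ , v₀₁₀) ∷ (v₁₀₀ , v₀₀₀) ∷ [])
  ; CI-tree-b₁ = forestFrom _ (_≟ᵛ v₀₀₀) ((v₀₁₀ , v₀₀₀) ∷ (v₁₀₀ , v₀₀₀) ∷ (v₀₁₁ , v₀₁₀) ∷ [])
  ; CJ-forest-true = forestFrom _ (roots? v₀₀₁ v₁₁₀) ((v₀₁₀ , v₁₁₀) ∷ (v₁₀₀ , v₁₁₀) ∷ [])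
  ; CJ-forest-false = forestFrom _ (roots? v₀₁₁ v₀₀₀) ((v₁₁₁ , v₀₁₁) ∷ (v₁₀₁ , v₁₁₁) ∷ [])
  }

cutSizes₃ : CutSizes quartet₃
cutSizes₃ = record { C-surplus = refl ; CI-surplus = refl ; CJ-surplus = refl }

quartets : ∀ k → Σ (CertifiedQuartet (3 + k)) CutSizes
quartets zero = quartet₃ , cutSizes₃
quartets (suc k) with quartets k
... | K , sizes = CertifiedQuartetProperties.extend K , extend-cutSizes sizes

C₂ : Vertex 2 → Bool
C₂ (x ∷ _) = x

C₂-isHamiltonian : IsHamiltonianColoring (Q 2) C₂
C₂-isHamiltonian =
  RootedTree⇒IsTree (forestFrom (class C₂ true) (_≟ᵛ (true ∷ false ∷ [])) (((true ∷ true ∷ []) , (true ∷ false ∷ [])) ∷ [])) ,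
  RootedTree⇒IsTree (forestFrom (class C₂ false) (_≟ᵛ (false ∷ false ∷ [])) (((false ∷ true ∷ []) , (false ∷ false ∷ [])) ∷ []))

corollary3 : ((n : ℕ) → 2 ≤ n → DualHamiltonian (Q n))
    × ((n : ℕ) → 3 ≤ n → Σ (Coloring (Q n)) λ C → IsHamiltonianColoring (Q n) C × HasQuartet (Q n) C)
corollary3 = dual-hamiltonian , hamiltonian-coloring-with-quartet
  where
    dual-hamiltonian : (n : ℕ) → 2 ≤ n → DualHamiltonian (Q n)
    dual-hamiltonian 1 (s≤s ())
    dual-hamiltonian 2 _ = cut-isHamiltonianBond C₂ C₂-isHamiltonian refl
    dual-hamiltonian (suc (suc (suc k))) _ with quartets k
    ... | K , sizes = cut-isHamiltonianBond C isHamiltonian C-surplus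
      where
        open CertifiedQuartet K
        open CertifiedQuartetProperties K
        open CutSizes sizes
    hamiltonian-coloring-with-quartet : (n : ℕ) → 3 ≤ n → Σ (Coloring (Q n)) λ C → IsHamiltonianColoring (Q n) C × HasQuartet (Q n) C
    hamiltonian-coloring-with-quartet 1 (s≤s ())
    hamiltonian-coloring-with-quartet 2 (s≤s (s≤s ()))
    hamiltonian-coloring-with-quartet (suc (suc (suc k))) _ with quartets k
    ... | K , _ = C , isHamiltonian , a₁ , a₂ , b₁ , b₂ , isQuartet
      where
        open CertifiedQuartet K
        open CertifiedQuartetProperties K
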